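{- Let $G$ be a group with monoid presentation $\mathrm{mon}\langle X_G, R_G\rangle$, $\theta : X_G^* \to G$ the natural monoid homomorphism, and $X_H, X_K \subseteq X_G^*$ such that $\theta(X_H)$ generates a subgroup $H$ and $\theta(X_K)$ generates a subgroup $K$ of $G$. With new symbols $H,K$, let $T_+ = (\{H,K\}\cup X_G)^*$, $T=\{HwK : w\in X_G^*\}$, and $R = R_G \cup \{(Hh, H) : h \in X_H\} \cup \{(kK, K) : k \in X_K\}$. Suppose the Knuth–Bendix completion algorithm (described in the context), applied to $R$ with a compatible well-ordering on $T_+$, terminates with output $R^C$. Then the restriction of $\to_{R^C}$ to $T$ is a complete rewriting system which is equivalent to the restriction of $\to_R$ to $T$ (i.e. the restrictions to $T$ of $\stackrel{*}{\leftrightarrow}_{R^C}$ and $\stackrel{*}{\leftrightarrow}_R$ coincide).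
   Context: For a rewriting system $R$ on $T_+$, $\to_R$ is the relation $ulv\to urv$ for $(l,r)\in R$, and $\stackrel{*}{\leftrightarrow}_R$ its reflexive symmetric transitive closure. Complete means terminating and confluent. The completion algorithm: (K1) start with $R$ and a well-ordering on $T_+$ compatible with multiplication; (K2) find all overlaps of pairs of rules $(l_1,r_1),(l_2,r_2)$, i.e. $ul_1v=l_2$ or $ul_1=l_2v$, and record the critical pairs $(ur_1v,r_2)$, resp. $(ur_1,r_2v)$; (K3) reduce both terms of each critical pair with respect to $R$; if the reduced terms differ, orient the pair by the well-ordering and add it as a new rule to $R$; (K4) if new rules were added, repeat (K2)–(K3) for pairs involving new rules; otherwise (K5) output the resulting system $R^C$, which is complete on $T_+$ with respect to the ordering. -}

module Defs where

open import Data.List using (List; []; _∷_; _++_; map; [_])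
open import Data.List.Membership.Propositional using (_∈_)
open import Data.List.Relation.Unary.All using (All)
open import Data.Product using (Σ; ∃; ∃-syntax; _×_; _,_)
open import Data.Sum using (_⊎_)
open import Relation.Binary.PropositionalEquality using (_≡_; _≢_)
open import Relation.Binary.Construct.Closure.ReflexiveTransitive using (Star)
open import Relation.Nullary using (¬_)
open import Induction.WellFounded using (WellFounded)

Rule : Set → Set
Rule B = List B × List B

System : Set → Set
System B = List (Rule B)

data Step {B : Set} (S : System B) : List B → List B → Set where
  step : ∀ {l r} (p q : List B) → (l , r) ∈ S →
         Step S (p ++ l ++ q) (p ++ r ++ q)

Irreducible : {B : Set} → System B → List B → Set
Irreducible S w = ∀ w' → ¬ Step S w w'

NormalForm : {B : Set} → System B → List B → List B → Set
NormalForm S w w' = Star (Step S) w w' × Irreducible S w'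

data CriticalPair {B : Set} : Rule B → Rule B → List B × List B → Set where
  inner : ∀ {l₁ r₁ r₂} (u v : List B) →
          CriticalPair (l₁ , r₁) (u ++ l₁ ++ v , r₂) (u ++ r₁ ++ v , r₂)
  proper : ∀ {r₁ r₂} (u s v : List B) → u ≢ [] → s ≢ [] → v ≢ [] →
          CriticalPair (s ++ v , r₁) (u ++ s , r₂) (u ++ r₁ , r₂ ++ v)

IsCP : {B : Set} → System B → System B → List B × List B → Set
IsCP S N cp = ∃[ ρ₁ ] ∃[ ρ₂ ] (ρ₁ ∈ S × ρ₂ ∈ S × (ρ₁ ∈ N ⊎ ρ₂ ∈ N) × CriticalPair ρ₁ ρ₂ cp)

AllCPs : {B : Set} → System B → System B → List (List B × List B) → Set
AllCPs S N CP = (∀ cp → IsCP S N cp → cp ∈ CP) × All (IsCP S N) CP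

module Completion {B : Set} (_≺_ : List B → List B → Set) where

  data ProcessPair (S : System B) (a b : List B) : System B → Set where
    joinable : ∀ {c} → NormalForm S a c → NormalForm S b c → ProcessPair S a b S
    addLR : ∀ {a' b'} → NormalForm S a a' → NormalForm S b b' → a' ≢ b' →
            b' ≺ a' → ProcessPair S a b (S ++ [ (a' , b') ])
    addRL : ∀ {a' b'} → NormalForm S a a' → NormalForm S b b' → a' ≢ b' →
            a' ≺ b' → ProcessPair S a b (S ++ [ (b' , a') ])

  data ProcessAll : System B → List (List B × List B) → System B → Set where
    []  : ∀ {S} → ProcessAll S [] S
    _∷_ : ∀ {S S' S'' a b cps} → ProcessPair S a b S' → ProcessAll S' cps S'' →
          ProcessAll S ((a , b) ∷ cps) S''

  -- one round (K2)+(K3): from system S whose newly added rules are N,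
  -- the round adds the rules N'
  Round : System B → System B → System B → Set
  Round S N N' = ∃[ CP ] (AllCPs S N CP × ProcessAll S CP (S ++ N'))

  data Completes : System B → System B → System B → Set where
    done : ∀ {S N} → Round S N [] → Completes S N S
    more : ∀ {S N N' Sc} → Round S N N' → N' ≢ [] →
           Completes (S ++ N') N' Sc → Completes S N Sc

  data Orient : System B → System B → Set where
    []   : Orient [] []
    keep : ∀ {l r R R₀} → r ≺ l → Orient R R₀ → Orient ((l , r) ∷ R) ((l , r) ∷ R₀)
    flip : ∀ {l r R R₀} → l ≺ r → Orient R R₀ → Orient ((l , r) ∷ R) ((r , l) ∷ R₀)
    drop : ∀ {l r R R₀} → l ≡ r → Orient R R₀ → Orient ((l , r) ∷ R) R₀

  CompletionOutput : System B → System B → Set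
  CompletionOutput R Rc = ∃[ R₀ ] (Orient R R₀ × Completes R₀ R₀ Rc)

Terminating : {W : Set} → (W → W → Set) → Set
Terminating _⟶_ = WellFounded (λ y x → x ⟶ y)

Confluent : {W : Set} → (W → W → Set) → Set
Confluent _⟶_ = ∀ {a b c} → Star _⟶_ a b → Star _⟶_ a c →
                ∃[ d ] (Star _⟶_ b d × Star _⟶_ c d)

Complete : {W : Set} → (W → W → Set) → Set
Complete _⟶_ = Terminating _⟶_ × Confluent _⟶_

data Sym (A : Set) : Set where
  H K : Sym A
  x   : A → Sym A

⌜_⌝ : {A : Set} → List A → List (Sym A)
⌜ w ⌝ = map x w

cosetSystem : {A : Set} → System A → List (List A) → List (List A) → System (Sym A)
cosetSystem RG XH XK =
  map (λ { (u , v) → (⌜ u ⌝ , ⌜ v ⌝) }) RG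
  ++ map (λ h → (H ∷ ⌜ h ⌝ , [ H ])) XH
  ++ map (λ k → (⌜ k ⌝ ++ [ K ] , [ K ])) XK

InT : {A : Set} → List (Sym A) → Set
InT {A} t = ∃[ w ] (t ≡ H ∷ ⌜ w ⌝ ++ [ K ])

Restrict : {W : Set} → (W → Set) → (W → W → Set) → W → W → Set
Restrict P _⟶_ u v = P u × P v × (u ⟶ v)

module Submission where

-- Every rule produced by completion is decreasing, is an R-consequence, and is compatible with
-- the brackets H, K: both sides contain H at most as first letter and K at most as last letter,
-- and contain H (resp. K) simultaneously.  The rules of R are of this kind, rewriting a
-- bracketed word by such a rule yields a compatible word, and an overlap of two bracketed
-- left-hand sides is bracketed; so every critical pair, hence every added rule, is again of
-- this kind.  Consequently T = H X_G^* K is closed under →_{R^C}.  On T_+ the output is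
-- terminating (its rules decrease) and confluent (its critical pairs are joinable, Newman's
-- lemma), and both properties pass to the closed subset T.  The equivalences agree because
-- added rules are R-consequences and every rule of R is, up to orientation, a rule of R^C.

open import Defs
open import Algebra.Bundles using (Group)
open import Data.Empty using (⊥; ⊥-elim)
open import Data.List using (List; []; _∷_; _++_; [_]; map; reverse; drop)
open import Data.List.Properties using (++-assoc; ++-identityʳ; ∷-injective; reverse-++; reverse-involutive)
open import Data.List.Membership.Propositional using (_∈_; _∉_)
open import Data.List.Membership.Propositional.Properties using (∈-++⁺ˡ; ∈-++⁺ʳ; ∈-++⁻; ∈-map⁻; ∈-∃++)
open import Data.List.Relation.Binary.Subset.Propositional using (_⊆_)
open import Data.List.Relation.Binary.Subset.Propositional.Properties using (⊆-reflexive; xs⊆xs++ys)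
open import Data.List.Relation.Unary.All using (All; []; _∷_)
import Data.List.Relation.Unary.All as All
import Data.List.Relation.Unary.All.Properties as All
open import Data.List.Relation.Unary.Any using (here; there)
open import Data.List.Relation.Unary.Any.Properties using (reverse⁺; reverse⁻)
open import Data.Product using (∃-syntax; _×_; _,_; proj₁; proj₂; uncurry)
import Data.Product as Product
open import Data.Sum using (_⊎_; inj₁; inj₂; [_,_]′)
import Data.Sum as Sum
open import Function using (id; _∘_; const; _⇔_; mk⇔; Equivalence)
open import Function.Properties.Equivalence using (⇔-isEquivalence)
open import Induction.WellFounded using (WellFounded; Acc; acc; module Subrelation)
open import Level using (0ℓ)
open import Relation.Binary.Construct.Closure.Equivalence using (EqClosure; _⋆)
import Relation.Binary.Construct.Closure.Equivalence as EqClosure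
open import Relation.Binary.Construct.Closure.ReflexiveTransitive using (Star; ε; _◅_; _◅◅_)
import Relation.Binary.Construct.Closure.ReflexiveTransitive as Star
open import Relation.Binary.Construct.Closure.Transitive using (Plus; module Plus; _∼⁺⟨_⟩_)
open import Relation.Binary.PropositionalEquality using (_≡_; _≢_; refl; sym; trans; cong; subst; subst₂)
open import Relation.Binary.Rewriting using (WeaklyConfluent; StronglyNormalizing; sn&wcr⇒cr)
open import Relation.Binary.Structures using (IsEquivalence; IsStrictTotalOrder)
open import Relation.Nullary using (¬_; contradiction)

open Equivalence using (to; from)

module _ {X : Set} where

  ++-split : (xs ys zs ws : List X) → xs ++ ys ≡ zs ++ ws →
             (∃[ m ] (zs ≡ xs ++ m × ys ≡ m ++ ws)) ⊎
             (∃[ m ] (m ≢ [] × xs ≡ zs ++ m × ws ≡ m ++ ys))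
  ++-split []       ys zs       ws eq = inj₁ (zs , refl , eq)
  ++-split (a ∷ xs) ys []       ws eq = inj₂ (a ∷ xs , (λ ()) , refl , sym eq)
  ++-split (a ∷ xs) ys (b ∷ zs) ws eq with ∷-injective eq
  ... | refl , eq′ with ++-split xs ys zs ws eq′
  ... | inj₁ (m , refl , eq″)        = inj₁ (m , refl , eq″)
  ... | inj₂ (m , m≢[] , refl , eq″) = inj₂ (m , m≢[] , refl , eq″)

  ∈-replace : ∀ {y : X} p {l r} q → (y ∈ l → y ∈ r) → y ∈ p ++ l ++ q → y ∈ p ++ r ++ q
  ∈-replace p {l} {r} q l⇒r y∈ with ∈-++⁻ p y∈
  ... | inj₁ y∈p = ∈-++⁺ˡ y∈p
  ... | inj₂ y∈lq with ∈-++⁻ l y∈lq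
  ... | inj₁ y∈l = ∈-++⁺ʳ p (∈-++⁺ˡ (l⇒r y∈l))
  ... | inj₂ y∈q = ∈-++⁺ʳ p (∈-++⁺ʳ r y∈q)

  Joinable : System X → List X → List X → Set
  Joinable S a b = ∃[ d ] (Star (Step S) a d × Star (Step S) b d)

  CriticalPairsJoinable : System X → Set
  CriticalPairsJoinable S = ∀ {ρ₁ ρ₂ a b} → ρ₁ ∈ S → ρ₂ ∈ S → CriticalPair ρ₁ ρ₂ (a , b) → Joinable S a b

  peak : ∀ {ρ₁ ρ₂ : Rule X} {cp} → CriticalPair ρ₁ ρ₂ cp → List X
  peak (inner {l₁} u v)     = u ++ l₁ ++ v
  peak (proper u s v _ _ _) = u ++ s ++ v

module _ {X : Set} {S : System X} where

  step-≡ : ∀ {l r a b} p q → (l , r) ∈ S → a ≡ p ++ l ++ q → b ≡ p ++ r ++ q → Step S a b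
  step-≡ p q ρ∈S refl refl = step p q ρ∈S

  rule-step : ∀ {l r} → (l , r) ∈ S → Step S l r
  rule-step {l} {r} ρ∈S = step-≡ [] [] ρ∈S (sym (++-identityʳ l)) (sym (++-identityʳ r))

  step-++ˡ : ∀ {a b} p → Step S a b → Step S (p ++ a) (p ++ b)
  step-++ˡ p (step p′ q ρ∈S) = step-≡ (p ++ p′) q ρ∈S (sym (++-assoc p p′ _)) (sym (++-assoc p p′ _))

  step-++ʳ : ∀ {a b} q → Step S a b → Step S (a ++ q) (b ++ q)
  step-++ʳ q (step {l} {r} p q′ ρ∈S) = step-≡ p (q′ ++ q) ρ∈S (assoc l) (assoc r)
    where
    assoc : ∀ w → (p ++ w ++ q′) ++ q ≡ p ++ w ++ q′ ++ q
    assoc w = trans (++-assoc p _ q) (cong (p ++_) (++-assoc w q′ q))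

  eqClosure-++ : ∀ {a b} p q → EqClosure (Step S) a b → EqClosure (Step S) (p ++ a ++ q) (p ++ b ++ q)
  eqClosure-++ p q = EqClosure.gmap (λ w → p ++ w ++ q) (step-++ˡ p ∘ step-++ʳ q)

  joinable-sym : ∀ {a b} → Joinable S a b → Joinable S b a
  joinable-sym (d , a↠d , b↠d) = d , b↠d , a↠d

  joinable-++ˡ : ∀ {a b} p → Joinable S a b → Joinable S (p ++ a) (p ++ b)
  joinable-++ˡ p (d , a↠d , b↠d) = p ++ d , Star.gmap (p ++_) (step-++ˡ p) a↠d , Star.gmap (p ++_) (step-++ˡ p) b↠d

  joinable-++ʳ : ∀ {a b} q → Joinable S a b → Joinable S (a ++ q) (b ++ q)
  joinable-++ʳ q (d , a↠d , b↠d) = d ++ q , Star.gmap (_++ q) (step-++ʳ q) a↠d , Star.gmap (_++ q) (step-++ʳ q) b↠d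

  peak-stepˡ : ∀ {ρ₁ ρ₂ a b} → ρ₁ ∈ S → (c : CriticalPair ρ₁ ρ₂ (a , b)) → Step S (peak c) a
  peak-stepˡ ρ₁∈S (inner u v) = step u v ρ₁∈S
  peak-stepˡ ρ₁∈S (proper {r₁} u s v _ _ _) =
    step-≡ u [] ρ₁∈S (cong (u ++_) (sym (++-identityʳ (s ++ v)))) (cong (u ++_) (sym (++-identityʳ r₁)))

  peak-stepʳ : ∀ {ρ₁ ρ₂ a b} → ρ₂ ∈ S → (c : CriticalPair ρ₁ ρ₂ (a , b)) → Step S (peak c) b
  peak-stepʳ ρ₂∈S (inner u v)          = rule-step ρ₂∈S
  peak-stepʳ ρ₂∈S (proper u s v _ _ _) = step-≡ [] v ρ₂∈S (sym (++-assoc u s v)) refl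

module _ {X : Set} {S S′ : System X} (S⊆S′ : S ⊆ S′) where

  step-⊆ : ∀ {a b} → Step S a b → Step S′ a b
  step-⊆ (step p q ρ∈S) = step p q (S⊆S′ ρ∈S)

  star-⊆ : ∀ {a b} → Star (Step S) a b → Star (Step S′) a b
  star-⊆ = Star.map step-⊆

  joinable-⊆ : ∀ {a b} → Joinable S a b → Joinable S′ a b
  joinable-⊆ (d , a↠d , b↠d) = d , star-⊆ a↠d , star-⊆ b↠d

module _ {X : Set} {S : System X} (joinable : CriticalPairsJoinable S) where

  disjoint-redexes-joinable : ∀ {l₁ r₁ l₂ r₂} → (l₁ , r₁) ∈ S → (l₂ , r₂) ∈ S → ∀ n q →
                              Joinable S (r₁ ++ n ++ l₂ ++ q) (l₁ ++ n ++ r₂ ++ q)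
  disjoint-redexes-joinable {r₁ = r₁} {r₂ = r₂} ρ₁∈S ρ₂∈S n q =
    r₁ ++ n ++ r₂ ++ q
    , step-≡ (r₁ ++ n) q ρ₂∈S (sym (++-assoc r₁ n _)) (sym (++-assoc r₁ n _)) ◅ ε
    , step [] (n ++ r₂ ++ q) ρ₁∈S ◅ ε

  -- The redexes are disjoint, or l₂ lies inside l₁, or l₁ is a proper prefix of l₂, or they overlap properly.
  redexes-joinable : ∀ {l₁ r₁ l₂ r₂} q₁ m q₂ → (l₁ , r₁) ∈ S → (l₂ , r₂) ∈ S →
                     l₁ ++ q₁ ≡ m ++ l₂ ++ q₂ → Joinable S (r₁ ++ q₁) (m ++ r₂ ++ q₂)
  redexes-joinable {l₁} {r₁} {l₂} {r₂} q₁ m q₂ ρ₁∈S ρ₂∈S eq with ++-split l₁ q₁ m (l₂ ++ q₂) eq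
  ... | inj₁ (n , refl , refl) =
        subst (Joinable S _) (sym (++-assoc l₁ n _)) (disjoint-redexes-joinable ρ₁∈S ρ₂∈S n q₂)
  ... | inj₂ (n , n≢[] , refl , eq′) with ++-split l₂ q₂ n q₁ eq′
  ... | inj₁ (o , refl , refl) =
        subst (Joinable S _) (trans (++-assoc m (r₂ ++ o) q₁) (cong (m ++_) (++-assoc r₂ o q₁)))
          (joinable-sym (joinable-++ʳ q₁ (joinable ρ₂∈S ρ₁∈S (inner m o))))
  redexes-joinable {r₁ = r₁} q₁ [] q₂ ρ₁∈S ρ₂∈S eq | inj₂ (n , n≢[] , refl , eq′) | inj₂ (o , o≢[] , refl , refl) =
        subst₂ (Joinable S) (++-assoc r₁ o q₂) refl (joinable-++ʳ q₂ (joinable ρ₁∈S ρ₂∈S (inner [] o)))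
  redexes-joinable {r₁ = r₁} {r₂ = r₂} q₁ m@(_ ∷ _) q₂ ρ₁∈S ρ₂∈S eq | inj₂ (n , n≢[] , refl , eq′) | inj₂ (o , o≢[] , refl , refl) =
        subst₂ (Joinable S) (++-assoc r₁ o q₂) (++-assoc m r₂ q₂)
          (joinable-sym (joinable-++ʳ q₂ (joinable ρ₂∈S ρ₁∈S (proper m n o (λ ()) n≢[] o≢[]))))

  criticalPairs⇒weaklyConfluent : WeaklyConfluent (Step S)
  criticalPairs⇒weaklyConfluent s t = join s t refl
    where
    join : ∀ {a a′ b c} → Step S a b → Step S a′ c → a ≡ a′ → Joinable S b c
    join (step {l₁} p₁ q₁ ρ₁∈S) (step {l₂} p₂ q₂ ρ₂∈S) eq with ++-split p₁ (l₁ ++ q₁) p₂ (l₂ ++ q₂) eq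
    ... | inj₁ (m , refl , eq′) =
          subst (Joinable S _) (sym (++-assoc p₁ m _)) (joinable-++ˡ p₁ (redexes-joinable q₁ m q₂ ρ₁∈S ρ₂∈S eq′))
    ... | inj₂ (m , _ , refl , eq′) =
          joinable-sym (subst (Joinable S _) (sym (++-assoc p₂ m _)) (joinable-++ˡ p₂ (redexes-joinable q₂ m q₁ ρ₂∈S ρ₁∈S eq′)))

module _ {X : Set} (_≺_ : List X → List X → Set) (wf : WellFounded _≺_)
         (≺-mono : ∀ p q u v → u ≺ v → (p ++ u ++ q) ≺ (p ++ v ++ q)) where

  -- otherwise [] ≻ r ≻ r r ≻ r r r ≻ … would descend forever
  ≺[]-impossible : ∀ {r} → ¬ (r ≺ [])
  ≺[]-impossible {r} r≺[] = descend (wf [])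
    where
    descend : ∀ {w} → Acc _≺_ w → ⊥
    descend {w} (acc rs) = descend (rs (≺-mono [] w r [] r≺[]))

  module _ {S : System X} (decreasing : ∀ {l r} → (l , r) ∈ S → r ≺ l) where

    step-decreasing : ∀ {a b} → Step S a b → b ≺ a
    step-decreasing (step {l} {r} p q ρ∈S) = ≺-mono p q r l (decreasing ρ∈S)

    step-terminating : Terminating (Step S)
    step-terminating = Subrelation.wellFounded step-decreasing wf

    plus-terminating : (∀ {a b c} → a ≺ b → b ≺ c → a ≺ c) → StronglyNormalizing (Plus (Step S))
    plus-terminating ≺-trans = Subrelation.wellFounded plus-decreasing wf
      where
      plus-decreasing : ∀ {a b} → Plus (Step S) a b → b ≺ a
      plus-decreasing Plus.[ s ]    = step-decreasing s
      plus-decreasing (_ ∼⁺⟨ s ⟩ t) = ≺-trans (plus-decreasing t) (plus-decreasing s)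

module _ {W : Set} {_⟶_ : W → W → Set} (P : W → Set) (closed : ∀ {a b} → P a → a ⟶ b → P b) where

  star-closed : ∀ {a b} → P a → Star _⟶_ a b → P b
  star-closed pa ε = pa
  star-closed pa (s ◅ ss) = star-closed (closed pa s) ss

  star-restrict : ∀ {a b} → P a → Star _⟶_ a b → Star (Restrict P _⟶_) a b
  star-restrict pa ε = ε
  star-restrict pa (s ◅ ss) = (pa , closed pa s , s) ◅ star-restrict (closed pa s) ss

  unrestrict : ∀ {a b} → Star (Restrict P _⟶_) a b → Star _⟶_ a b
  unrestrict = Star.map (proj₂ ∘ proj₂)

  restrict-confluent : Confluent _⟶_ → Confluent (Restrict P _⟶_)
  restrict-confluent confluent ε a↠c = _ , a↠c , ε
  restrict-confluent confluent a↠b@((pa , _) ◅ _) a↠c with confluent (unrestrict a↠b) (unrestrict a↠c)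
  ... | d , b↠d , c↠d =
        d , star-restrict (star-closed pa (unrestrict a↠b)) b↠d , star-restrict (star-closed pa (unrestrict a↠c)) c↠d

restrict-terminating : ∀ {W : Set} {_⟶_ : W → W → Set} (P : W → Set) →
                       Terminating _⟶_ → Terminating (Restrict P _⟶_)
restrict-terminating P = Subrelation.wellFounded (proj₂ ∘ proj₂)

module _ {X : Set} (y : X) where

  OnlyAtHead : List X → Set
  OnlyAtHead t = y ∉ drop 1 t

  OnlyAtLast : List X → Set
  OnlyAtLast t = OnlyAtHead (reverse t)

  ∉⇒onlyAtHead : ∀ {t} → y ∉ t → OnlyAtHead t
  ∉⇒onlyAtHead {[]}    _   ()
  ∉⇒onlyAtHead {_ ∷ _} y∉t = y∉t ∘ there

  onlyAtHead-replace : ∀ p {l r} q → OnlyAtHead (p ++ l ++ q) → OnlyAtHead r → (y ∈ r → y ∈ l) → l ≢ [] →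
                       OnlyAtHead (p ++ r ++ q)
  onlyAtHead-replace (_ ∷ p) q hd _ r⇒l _ = hd ∘ ∈-replace p q r⇒l
  onlyAtHead-replace [] {[]} q hd _ _ l≢[] = contradiction refl l≢[]
  onlyAtHead-replace [] {_ ∷ l} {[]} q hd _ _ _ = ∉⇒onlyAtHead (hd ∘ ∈-++⁺ʳ l)
  onlyAtHead-replace [] {_ ∷ l} {_ ∷ r} q hd hr _ _ y∈ with ∈-++⁻ r y∈
  ... | inj₁ y∈r = hr y∈r
  ... | inj₂ y∈q = hd (∈-++⁺ʳ l y∈q)

  onlyAtHead-glue : ∀ a {s} b → OnlyAtHead (a ++ s) → OnlyAtHead (s ++ b) → s ≢ [] → OnlyAtHead (a ++ s ++ b)
  onlyAtHead-glue []      b _  hd₂ _ = hd₂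
  onlyAtHead-glue (_ ∷ a) {[]} b _ _ s≢[] = contradiction refl s≢[]
  onlyAtHead-glue (_ ∷ a) {_ ∷ s} b hd₁ hd₂ _ y∈ with ∈-++⁻ a y∈
  ... | inj₁ y∈a          = hd₁ (∈-++⁺ˡ y∈a)
  ... | inj₂ (here refl)  = hd₁ (∈-++⁺ʳ a (here refl))
  ... | inj₂ (there y∈sb) = hd₂ y∈sb

  onlyAtHead-split : ∀ a b → OnlyAtHead (a ++ y ∷ b) → a ≡ [] × y ∉ b
  onlyAtHead-split []      b hd = refl , hd
  onlyAtHead-split (_ ∷ a) b hd = contradiction (∈-++⁺ʳ a (here refl)) hd

  private
    reverse≢[] : ∀ {l : List X} → l ≢ [] → reverse l ≢ []
    reverse≢[] {l} l≢[] eq = l≢[] (trans (sym (reverse-involutive l)) (cong reverse eq))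

    reverse-++₃ : ∀ (p l q : List X) → reverse (p ++ l ++ q) ≡ reverse q ++ reverse l ++ reverse p
    reverse-++₃ p l q = trans (reverse-++ p (l ++ q))
      (trans (cong (_++ reverse p) (reverse-++ l q)) (++-assoc (reverse q) (reverse l) (reverse p)))

  ∉⇒onlyAtLast : ∀ {t} → y ∉ t → OnlyAtLast t
  ∉⇒onlyAtLast y∉t = ∉⇒onlyAtHead (y∉t ∘ reverse⁻)

  onlyAtLast-∷ʳ : ∀ a → y ∉ a → OnlyAtLast (a ++ [ y ])
  onlyAtLast-∷ʳ a y∉a = subst OnlyAtHead (sym (reverse-++ a [ y ])) (y∉a ∘ reverse⁻)

  onlyAtLast-replace : ∀ p {l r} q → OnlyAtLast (p ++ l ++ q) → OnlyAtLast r → (y ∈ r → y ∈ l) → l ≢ [] →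
                       OnlyAtLast (p ++ r ++ q)
  onlyAtLast-replace p {l} {r} q lt lr r⇒l l≢[] =
    subst OnlyAtHead (sym (reverse-++₃ p r q))
      (onlyAtHead-replace (reverse q) (reverse p) (subst OnlyAtHead (reverse-++₃ p l q) lt) lr
        (reverse⁺ ∘ r⇒l ∘ reverse⁻) (reverse≢[] l≢[]))

  onlyAtLast-glue : ∀ a {s} b → OnlyAtLast (a ++ s) → OnlyAtLast (s ++ b) → s ≢ [] → OnlyAtLast (a ++ s ++ b)
  onlyAtLast-glue a {s} b lt₁ lt₂ s≢[] =
    subst OnlyAtHead (sym (reverse-++₃ a s b))
      (onlyAtHead-glue (reverse b) (reverse a) (subst OnlyAtHead (reverse-++ s b) lt₂)
        (subst OnlyAtHead (reverse-++ a s) lt₁) (reverse≢[] s≢[]))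

  onlyAtLast-split : ∀ a b → OnlyAtLast (a ++ y ∷ b) → b ≡ [] × y ∉ a
  onlyAtLast-split a b lt
    with onlyAtHead-split (reverse b) (reverse a) (subst OnlyAtHead (reverse-++₃ a [ y ] b) lt)
  ... | rev-b≡[] , y∉rev-a = trans (sym (reverse-involutive b)) (cong reverse rev-b≡[]) , y∉rev-a ∘ reverse⁺

module _ {X : Set} (h k : X) where

  Bracketed : List X → Set
  Bracketed t = OnlyAtHead h t × OnlyAtLast k t

  record Compatible (a b : List X) : Set where
    field
      bracketedˡ : Bracketed a
      bracketedʳ : Bracketed b
      h-agrees   : h ∈ a ⇔ h ∈ b
      k-agrees   : k ∈ a ⇔ k ∈ b

  open Compatible

  private
    module ⇔ = IsEquivalence (⇔-isEquivalence {ℓ = 0ℓ})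

  compatible-refl : ∀ {a} → Bracketed a → Compatible a a
  compatible-refl ba = record { bracketedˡ = ba ; bracketedʳ = ba ; h-agrees = ⇔.refl ; k-agrees = ⇔.refl }

  compatible-sym : ∀ {a b} → Compatible a b → Compatible b a
  compatible-sym c = record
    { bracketedˡ = bracketedʳ c ; bracketedʳ = bracketedˡ c
    ; h-agrees = ⇔.sym (h-agrees c) ; k-agrees = ⇔.sym (k-agrees c) }

  compatible-trans : ∀ {a b c} → Compatible a b → Compatible b c → Compatible a c
  compatible-trans c₁ c₂ = record
    { bracketedˡ = bracketedˡ c₁ ; bracketedʳ = bracketedʳ c₂
    ; h-agrees = ⇔.trans (h-agrees c₁) (h-agrees c₂) ; k-agrees = ⇔.trans (k-agrees c₁) (k-agrees c₂) }

  compatible-replace : ∀ p {l r} q → Bracketed (p ++ l ++ q) → Compatible l r → l ≢ [] →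
                       Compatible (p ++ l ++ q) (p ++ r ++ q)
  compatible-replace p q (hd , lt) c l≢[] = record
    { bracketedˡ = hd , lt
    ; bracketedʳ = onlyAtHead-replace h p q hd (proj₁ (bracketedʳ c)) (from (h-agrees c)) l≢[]
                 , onlyAtLast-replace k p q lt (proj₂ (bracketedʳ c)) (from (k-agrees c)) l≢[]
    ; h-agrees = replace-⇔ (h-agrees c)
    ; k-agrees = replace-⇔ (k-agrees c) }
    where
    replace-⇔ : ∀ {y l r} → y ∈ l ⇔ y ∈ r → y ∈ p ++ l ++ q ⇔ y ∈ p ++ r ++ q
    replace-⇔ l⇔r = mk⇔ (∈-replace p q (to l⇔r)) (∈-replace p q (from l⇔r))

  bracketed-glue : ∀ a {s} b → Bracketed (a ++ s) → Bracketed (s ++ b) → s ≢ [] → Bracketed (a ++ s ++ b)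
  bracketed-glue a b (hd₁ , lt₁) (hd₂ , lt₂) s≢[] =
    onlyAtHead-glue h a b hd₁ hd₂ s≢[] , onlyAtLast-glue k a b lt₁ lt₂ s≢[]

module CompletionInvariant {B : Set} (_≺_ : List B → List B → Set) (Good : Rule B → Set)
  (good-orientation : ∀ {S ρ₁ ρ₂ a b x y} → All Good S → ρ₁ ∈ S → ρ₂ ∈ S → (c : CriticalPair ρ₁ ρ₂ (a , b)) →
                      Star (Step S) (peak c) x → Star (Step S) (peak c) y → y ≺ x → Good (x , y)) where

  open Completion _≺_

  CriticalPairOf : System B → List B × List B → Set
  CriticalPairOf S cp = ∃[ ρ₁ ] ∃[ ρ₂ ] (ρ₁ ∈ S × ρ₂ ∈ S × CriticalPair ρ₁ ρ₂ cp)

  criticalPairOf-⊆ : ∀ {S S′ cp} → S ⊆ S′ → CriticalPairOf S cp → CriticalPairOf S′ cp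
  criticalPairOf-⊆ S⊆S′ (ρ₁ , ρ₂ , ρ₁∈S , ρ₂∈S , c) = ρ₁ , ρ₂ , S⊆S′ ρ₁∈S , S⊆S′ ρ₂∈S , c

  CriticalPairsJoinableExcept : System B → System B → Set
  CriticalPairsJoinableExcept S N = ∀ {ρ₁ ρ₂ a b} → ρ₁ ∈ S → ρ₂ ∈ S → CriticalPair ρ₁ ρ₂ (a , b) →
                                    (ρ₁ ∈ N ⊎ ρ₂ ∈ N) ⊎ Joinable S a b

  processPair-sound : ∀ {S S′ a b} → All Good S → CriticalPairOf S (a , b) → ProcessPair S a b S′ →
                      All Good S′ × S ⊆ S′ × Joinable S′ a b
  processPair-sound good _ (joinable (a↠c , _) (b↠c , _)) = good , id , _ , a↠c , b↠c
  processPair-sound {S} good (_ , _ , ρ₁∈S , ρ₂∈S , c) (addLR {b' = b′} (a↠a′ , _) (b↠b′ , _) _ b′≺a′) =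
    All.++⁺ good (good-orientation good ρ₁∈S ρ₂∈S c (peak-stepˡ ρ₁∈S c ◅ a↠a′) (peak-stepʳ ρ₂∈S c ◅ b↠b′) b′≺a′ ∷ [])
    , xs⊆xs++ys S _
    , b′ , star-⊆ (xs⊆xs++ys S _) a↠a′ ◅◅ rule-step (∈-++⁺ʳ S (here refl)) ◅ ε , star-⊆ (xs⊆xs++ys S _) b↠b′
  processPair-sound {S} good (_ , _ , ρ₁∈S , ρ₂∈S , c) (addRL {a' = a′} (a↠a′ , _) (b↠b′ , _) _ a′≺b′) =
    All.++⁺ good (good-orientation good ρ₁∈S ρ₂∈S c (peak-stepʳ ρ₂∈S c ◅ b↠b′) (peak-stepˡ ρ₁∈S c ◅ a↠a′) a′≺b′ ∷ [])
    , xs⊆xs++ys S _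
    , a′ , star-⊆ (xs⊆xs++ys S _) a↠a′ , star-⊆ (xs⊆xs++ys S _) b↠b′ ◅◅ rule-step (∈-++⁺ʳ S (here refl)) ◅ ε

  processAll-sound : ∀ {S S′ cps} → All Good S → All (CriticalPairOf S) cps → ProcessAll S cps S′ →
                     All Good S′ × S ⊆ S′ × All (uncurry (Joinable S′)) cps
  processAll-sound good [] [] = good , id , []
  processAll-sound good (cp ∷ cps) (pp ∷ pa) with processPair-sound good cp pp
  ... | good′ , S⊆S′ , j with processAll-sound good′ (All.map (criticalPairOf-⊆ S⊆S′) cps) pa
  ... | good″ , S′⊆S″ , js = good″ , S′⊆S″ ∘ S⊆S′ , joinable-⊆ S′⊆S″ j ∷ js

  round-sound : ∀ {S N N′} → All Good S → Round S N N′ →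
                All Good (S ++ N′) × S ⊆ S ++ N′ ×
                (∀ {ρ₁ ρ₂ a b} → ρ₁ ∈ S → ρ₂ ∈ S → ρ₁ ∈ N ⊎ ρ₂ ∈ N → CriticalPair ρ₁ ρ₂ (a , b) → Joinable (S ++ N′) a b)
  round-sound good (cps , (all-listed , listed) , pa)
    with processAll-sound good (All.map (λ (ρ₁ , ρ₂ , ρ₁∈S , ρ₂∈S , _ , c) → ρ₁ , ρ₂ , ρ₁∈S , ρ₂∈S , c) listed) pa
  ... | good′ , S⊆S′ , js = good′ , S⊆S′ , λ ρ₁∈S ρ₂∈S new c → All.lookup js (all-listed _ (_ , _ , ρ₁∈S , ρ₂∈S , new , c))

  completes-sound : ∀ {S N Sc} → Completes S N Sc → All Good S → CriticalPairsJoinableExcept S N →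
                    All Good Sc × S ⊆ Sc × CriticalPairsJoinable Sc
  completes-sound {S} {N} (done rnd) good pending with round-sound good rnd
  ... | _ , _ , new-joinable = good , id , λ ρ₁∈S ρ₂∈S c → [ new⇒joinable ρ₁∈S ρ₂∈S c , id ]′ (pending ρ₁∈S ρ₂∈S c)
    where
    new⇒joinable : ∀ {ρ₁ ρ₂ a b} → ρ₁ ∈ S → ρ₂ ∈ S → CriticalPair ρ₁ ρ₂ (a , b) → ρ₁ ∈ N ⊎ ρ₂ ∈ N → Joinable S a b
    new⇒joinable ρ₁∈S ρ₂∈S c new = joinable-⊆ (⊆-reflexive (++-identityʳ S)) (new-joinable ρ₁∈S ρ₂∈S new c)
  completes-sound {S} {N} (more {N' = N′} rnd _ rest) good pending with round-sound good rnd
  ... | good′ , S⊆S′ , new-joinable with completes-sound rest good′ pending′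
    where
    pending′ : CriticalPairsJoinableExcept (S ++ N′) N′
    pending′ ρ₁∈ ρ₂∈ c with ∈-++⁻ S ρ₁∈ | ∈-++⁻ S ρ₂∈
    ... | inj₂ ρ₁∈N′ | _           = inj₁ (inj₁ ρ₁∈N′)
    ... | inj₁ _     | inj₂ ρ₂∈N′ = inj₁ (inj₂ ρ₂∈N′)
    ... | inj₁ ρ₁∈S  | inj₁ ρ₂∈S with pending ρ₁∈S ρ₂∈S c
    ... | inj₁ new = inj₂ (new-joinable ρ₁∈S ρ₂∈S new c)
    ... | inj₂ j   = inj₂ (joinable-⊆ S⊆S′ j)
  ... | good-c , S′⊆Sc , joinable-c = good-c , S′⊆Sc ∘ S⊆S′ , joinable-c

  completion-sound : ∀ {R₀ Rc} → Completes R₀ R₀ Rc → All Good R₀ → All Good Rc × R₀ ⊆ Rc × CriticalPairsJoinable Rc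
  completion-sound completes good = completes-sound completes good (λ ρ₁∈R₀ _ _ → inj₁ (inj₁ ρ₁∈R₀))

module _ {B : Set} {_≺_ : List B → List B → Set} where

  open Completion _≺_

  orient-rule : ∀ {Q Q₀ l r} → Orient Q Q₀ → (l , r) ∈ Q₀ → r ≺ l × ((l , r) ∈ Q ⊎ (r , l) ∈ Q)
  orient-rule (keep r≺l _) (here refl) = r≺l , inj₁ (here refl)
  orient-rule (flip l≺r _) (here refl) = l≺r , inj₂ (here refl)
  orient-rule (keep _ o)   (there ρ∈) = Product.map₂ (Sum.map there there) (orient-rule o ρ∈)
  orient-rule (flip _ o)   (there ρ∈) = Product.map₂ (Sum.map there there) (orient-rule o ρ∈)
  orient-rule (drop _ o)   ρ∈         = Product.map₂ (Sum.map there there) (orient-rule o ρ∈)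

  orient-rule-derivable : ∀ {Q Q₀ l r} → Orient Q Q₀ → (l , r) ∈ Q → EqClosure (Step Q₀) l r
  orient-rule-derivable (keep _ _)    (here refl) = EqClosure.return (rule-step (here refl))
  orient-rule-derivable (flip _ _)    (here refl) = EqClosure.symmetric _ (EqClosure.return (rule-step (here refl)))
  orient-rule-derivable (drop refl _) (here refl) = ε
  orient-rule-derivable (keep _ o)    (there ρ∈)  = EqClosure.map (step-⊆ there) (orient-rule-derivable o ρ∈)
  orient-rule-derivable (flip _ o)    (there ρ∈)  = EqClosure.map (step-⊆ there) (orient-rule-derivable o ρ∈)
  orient-rule-derivable (drop _ o)    (there ρ∈)  = orient-rule-derivable o ρ∈

  orient-step : ∀ {Q Q₀ a b} → Orient Q Q₀ → Step Q a b → EqClosure (Step Q₀) a b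
  orient-step o (step p q ρ∈Q) = eqClosure-++ p q (orient-rule-derivable o ρ∈Q)

module CosetCompletion {A : Set} (RG : System A) (XH XK : List (List A))
  (_≺_ : List (Sym A) → List (Sym A) → Set) (wf : WellFounded _≺_)
  (≺-mono : ∀ p q u v → u ≺ v → (p ++ u ++ q) ≺ (p ++ v ++ q)) where

  R : System (Sym A)
  R = cosetSystem RG XH XK

  ⌜⌝-rule : Rule A → Rule (Sym A)
  ⌜⌝-rule (u , v) = ⌜ u ⌝ , ⌜ v ⌝

  H-rule : List A → Rule (Sym A)
  H-rule h = H ∷ ⌜ h ⌝ , [ H ]

  K-rule : List A → Rule (Sym A)
  K-rule k = ⌜ k ⌝ ++ [ K ] , [ K ]

  Admissible : Rule (Sym A) → Set
  Admissible (l , r) = r ≺ l × EqClosure (Step R) l r × Compatible H K l r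

  H∉⌜⌝ : ∀ (w : List A) → H ∉ ⌜ w ⌝
  H∉⌜⌝ w H∈ with ∈-map⁻ x H∈
  ... | _ , _ , ()

  K∉⌜⌝ : ∀ (w : List A) → K ∉ ⌜ w ⌝
  K∉⌜⌝ w K∈ with ∈-map⁻ x K∈
  ... | _ , _ , ()

  ⌜⌝-bracketed : ∀ (w : List A) → Bracketed H K ⌜ w ⌝
  ⌜⌝-bracketed w = ∉⇒onlyAtHead H (H∉⌜⌝ w) , ∉⇒onlyAtLast K (K∉⌜⌝ w)

  ⌜⌝-preimage : ∀ (t : List (Sym A)) → H ∉ t → K ∉ t → ∃[ w ] t ≡ ⌜ w ⌝
  ⌜⌝-preimage []      _   _   = [] , refl
  ⌜⌝-preimage (H ∷ t) H∉t _   = contradiction (here refl) H∉t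
  ⌜⌝-preimage (K ∷ t) _   K∉t = contradiction (here refl) K∉t
  ⌜⌝-preimage (x a ∷ t) H∉t K∉t = Product.map (a ∷_) (cong (x a ∷_)) (⌜⌝-preimage t (H∉t ∘ there) (K∉t ∘ there))

  both-absent : ∀ {y : Sym A} {a b} → y ∉ a → y ∉ b → y ∈ a ⇔ y ∈ b
  both-absent y∉a y∉b = mk⇔ (⊥-elim ∘ y∉a) (⊥-elim ∘ y∉b)

  both-present : ∀ {y : Sym A} {a b} → y ∈ a → y ∈ b → y ∈ a ⇔ y ∈ b
  both-present y∈a y∈b = mk⇔ (const y∈b) (const y∈a)

  coset-rule-compatible : ∀ {l r} → (l , r) ∈ R → Compatible H K l r
  coset-rule-compatible ρ∈R with ∈-++⁻ (map ⌜⌝-rule RG) ρ∈R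
  ... | inj₁ ρ∈RG with ∈-map⁻ ⌜⌝-rule ρ∈RG
  ...   | (u , v) , _ , refl = record
          { bracketedˡ = ⌜⌝-bracketed u ; bracketedʳ = ⌜⌝-bracketed v
          ; h-agrees = both-absent (H∉⌜⌝ u) (H∉⌜⌝ v) ; k-agrees = both-absent (K∉⌜⌝ u) (K∉⌜⌝ v) }
  coset-rule-compatible ρ∈R | inj₂ ρ∈HK with ∈-++⁻ (map H-rule XH) ρ∈HK
  ... | inj₁ ρ∈XH with ∈-map⁻ H-rule ρ∈XH
  ...   | h , _ , refl = record
          { bracketedˡ = H∉⌜⌝ h , ∉⇒onlyAtLast K K∉Hh ; bracketedʳ = (λ ()) , (λ ())
          ; h-agrees = both-present (here refl) (here refl) ; k-agrees = both-absent K∉Hh (λ { (here ()) ; (there ()) }) }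
    where
    K∉Hh : K ∉ H ∷ ⌜ h ⌝
    K∉Hh = λ { (here ()) ; (there K∈) → K∉⌜⌝ h K∈ }
  coset-rule-compatible ρ∈R | inj₂ ρ∈HK | inj₂ ρ∈XK with ∈-map⁻ K-rule ρ∈XK
  ...   | k , _ , refl = record
          { bracketedˡ = ∉⇒onlyAtHead H H∉kK , onlyAtLast-∷ʳ K ⌜ k ⌝ (K∉⌜⌝ k) ; bracketedʳ = (λ ()) , (λ ())
          ; h-agrees = both-absent H∉kK (λ { (here ()) ; (there ()) }) ; k-agrees = both-present (∈-++⁺ʳ ⌜ k ⌝ (here refl)) (here refl) }
    where
    H∉kK : H ∉ ⌜ k ⌝ ++ [ K ]
    H∉kK H∈ with ∈-++⁻ ⌜ k ⌝ H∈
    ... | inj₁ H∈k = H∉⌜⌝ k H∈k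
    ... | inj₂ (here ())
    ... | inj₂ (there ())

  admissible-lhs≢[] : ∀ {l r} → Admissible (l , r) → l ≢ []
  admissible-lhs≢[] (r≺l , _) refl = ≺[]-impossible _≺_ wf ≺-mono r≺l

  module _ {S : System (Sym A)} (admissible : All Admissible S) where

    admissible-decreasing : ∀ {l r} → (l , r) ∈ S → r ≺ l
    admissible-decreasing = proj₁ ∘ All.lookup admissible

    step-derivable : ∀ {a b} → Step S a b → EqClosure (Step R) a b
    step-derivable (step p q ρ∈S) = eqClosure-++ p q (proj₁ (proj₂ (All.lookup admissible ρ∈S)))

    star-derivable : ∀ {a b} → Star (Step S) a b → EqClosure (Step R) a b
    star-derivable = Star.fold (EqClosure (Step R)) (_◅◅_ ∘ step-derivable) ε

    step-compatible : ∀ {a b} → Step S a b → Bracketed H K a → Compatible H K a b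
    step-compatible (step p q ρ∈S) a-bracketed =
      let ρ-admissible = All.lookup admissible ρ∈S in
      compatible-replace H K p q a-bracketed (proj₂ (proj₂ ρ-admissible)) (admissible-lhs≢[] ρ-admissible)

    star-compatible : ∀ {a b} → Star (Step S) a b → Bracketed H K a → Compatible H K a b
    star-compatible ε        a-bracketed = compatible-refl H K a-bracketed
    star-compatible (s ◅ ss) a-bracketed =
      let c = step-compatible s a-bracketed in
      compatible-trans H K c (star-compatible ss (Compatible.bracketedʳ c))

    lhs-bracketed : ∀ {l r} → (l , r) ∈ S → Bracketed H K l
    lhs-bracketed = Compatible.bracketedˡ ∘ proj₂ ∘ proj₂ ∘ All.lookup admissible

    peak-bracketed : ∀ {ρ₁ ρ₂ a b} → ρ₁ ∈ S → ρ₂ ∈ S → (c : CriticalPair ρ₁ ρ₂ (a , b)) → Bracketed H K (peak c)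
    peak-bracketed _    ρ₂∈S (inner u v)              = lhs-bracketed ρ₂∈S
    peak-bracketed ρ₁∈S ρ₂∈S (proper u s v _ s≢[] _) = bracketed-glue H K u v (lhs-bracketed ρ₂∈S) (lhs-bracketed ρ₁∈S) s≢[]

  InT⇒bracketed : ∀ {t : List (Sym A)} → InT t → Bracketed H K t × H ∈ t × K ∈ t
  InT⇒bracketed (w , refl) =
    (H∉⌜⌝K , onlyAtLast-∷ʳ K (H ∷ ⌜ w ⌝) λ { (here ()) ; (there K∈) → K∉⌜⌝ w K∈ })
    , here refl , there (∈-++⁺ʳ ⌜ w ⌝ (here refl))
    where
    H∉⌜⌝K : H ∉ ⌜ w ⌝ ++ [ K ]
    H∉⌜⌝K H∈ with ∈-++⁻ ⌜ w ⌝ H∈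
    ... | inj₁ H∈w = H∉⌜⌝ w H∈w
    ... | inj₂ (here ())
    ... | inj₂ (there ())

  bracketed⇒InT : ∀ {t : List (Sym A)} → Bracketed H K t → H ∈ t → K ∈ t → InT t
  bracketed⇒InT {_ ∷ t} (H∉t , _) (there H∈t) _ = contradiction H∈t H∉t
  bracketed⇒InT {_ ∷ t} (H∉t , K-last) (here refl) (there K∈t) with ∈-∃++ K∈t
  ... | a , b , refl with onlyAtLast-split K (H ∷ a) b K-last
  ... | refl , K∉Ha with ⌜⌝-preimage a (H∉t ∘ ∈-++⁺ˡ) (K∉Ha ∘ there)
  ... | w , refl = w , refl

  T-closed : ∀ {S} {t s : List (Sym A)} → All Admissible S → InT t → Step S t s → InT s
  T-closed admissible t∈T s =
    let t-bracketed , H∈t , K∈t = InT⇒bracketed t∈T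
        c = step-compatible admissible s t-bracketed
    in  bracketed⇒InT (Compatible.bracketedʳ c) (to (Compatible.h-agrees c) H∈t) (to (Compatible.k-agrees c) K∈t)

  admissible-orientation : ∀ {S ρ₁ ρ₂ a b x y} → All Admissible S → ρ₁ ∈ S → ρ₂ ∈ S →
                           (c : CriticalPair ρ₁ ρ₂ (a , b)) →
                           Star (Step S) (peak c) x → Star (Step S) (peak c) y → y ≺ x → Admissible (x , y)
  admissible-orientation admissible ρ₁∈S ρ₂∈S c peak↠x peak↠y y≺x =
    y≺x
    , EqClosure.symmetric _ (star-derivable admissible peak↠x) ◅◅ star-derivable admissible peak↠y
    , compatible-trans H K (compatible-sym H K (star-compatible admissible peak↠x peak-bracketed′))
                           (star-compatible admissible peak↠y peak-bracketed′)
    where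
    peak-bracketed′ : Bracketed H K (peak c)
    peak-bracketed′ = peak-bracketed admissible ρ₁∈S ρ₂∈S c

  orient-admissible : ∀ {R₀} → Completion.Orient _≺_ R R₀ → All Admissible R₀
  orient-admissible o = All.tabulate λ ρ∈R₀ → admissible (orient-rule o ρ∈R₀)
    where
    admissible : ∀ {l r} → r ≺ l × ((l , r) ∈ R ⊎ (r , l) ∈ R) → Admissible (l , r)
    admissible (r≺l , inj₁ ρ∈R) = r≺l , EqClosure.return (rule-step ρ∈R) , coset-rule-compatible ρ∈R
    admissible (r≺l , inj₂ ρ∈R) =
      r≺l , EqClosure.symmetric _ (EqClosure.return (rule-step ρ∈R)) , compatible-sym H K (coset-rule-compatible ρ∈R)

  open CompletionInvariant _≺_ Admissible admissible-orientation public using (completion-sound)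

  T-complete : ∀ {S} → (∀ {a b c} → a ≺ b → b ≺ c → a ≺ c) → All Admissible S → CriticalPairsJoinable S →
               Complete (Restrict InT (Step S))
  T-complete ≺-trans admissible joinable =
    restrict-terminating InT (step-terminating _≺_ wf ≺-mono (admissible-decreasing admissible))
    , restrict-confluent InT (T-closed admissible)
        (sn&wcr⇒cr (plus-terminating _≺_ wf ≺-mono (admissible-decreasing admissible) ≺-trans)
                   (criticalPairs⇒weaklyConfluent joinable))

mainTheorem4 : ∀ {c ℓ} (A : Set) (G : Group c ℓ) (θ : List A → Group.Carrier G)
    (RG : System A) (XH XK : List (List A)) →
    -- θ : X_G^* → G is the natural monoid homomorphism and mon⟨X_G , R_G⟩ presents G
    Group._≈_ G (θ []) (Group.ε G) →
    (∀ u v → Group._≈_ G (θ (u ++ v)) (Group._∙_ G (θ u) (θ v))) →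
    (∀ g → ∃[ w ] Group._≈_ G (θ w) g) →
    (∀ u v → (Group._≈_ G (θ u) (θ v) → EqClosure (Step RG) u v)
           × (EqClosure (Step RG) u v → Group._≈_ G (θ u) (θ v))) →
    -- a well-ordering on T_+ compatible with multiplication
    (_≺_ : List (Sym A) → List (Sym A) → Set) →
    IsStrictTotalOrder _≡_ _≺_ →
    WellFounded _≺_ →
    (∀ p q u v → u ≺ v → (p ++ u ++ q) ≺ (p ++ v ++ q)) →
    -- completion applied to R terminates with output R^C
    (Rc : System (Sym A)) →
    Completion.CompletionOutput _≺_ (cosetSystem RG XH XK) Rc →
    Complete (Restrict InT (Step Rc))
    × (∀ u v → InT u → InT v →
         (EqClosure (Step Rc) u v → EqClosure (Step (cosetSystem RG XH XK)) u v)
         × (EqClosure (Step (cosetSystem RG XH XK)) u v → EqClosure (Step Rc) u v))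
mainTheorem4 A G θ RG XH XK _ _ _ _ _≺_ ≺-sto wf ≺-mono Rc (R₀ , orientation , completion) =
  let admissible , R₀⊆Rc , joinable = completion-sound completion (orient-admissible orientation) in
  T-complete (IsStrictTotalOrder.trans ≺-sto) admissible joinable
  , λ _ _ _ _ → step-derivable admissible ⋆ , (EqClosure.map (step-⊆ R₀⊆Rc) ∘ orient-step orientation) ⋆
  where open CosetCompletion RG XH XK _≺_ wf ≺-mono
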